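{- Let $n$ be odd and let $v\in\mathbb{F}_2^n$ with $v_0=0$. Then $v$ works together with $\bar e$ if and only if $G_v$ has no induced subgraph on an odd number of vertices in which every vertex has odd outdegree.
   Context: Vectors in $\mathbb{F}_2^n$ are indexed $x=(x_0,\dots,x_{n-1})$ with indices mod $n$; $\sigma$ is the cyclic shift $(\sigma x)_{i+1}=x_i$. Vectors $v,w$ work together if for every $x\in\mathbb{F}_2^n$ there is $k\in\{0,\dots,n-1\}$ with $v\cdot\sigma^kx=w\cdot\sigma^kx=0$. $\bar e\in\mathbb{F}_2^n$ has $\bar e_0=0$, $\bar e_i=1$ for $i\ne0$. For $v\in\mathbb{F}_2^n$, $G_v$ is the Cayley digraph on vertex set $\mathbb{Z}/n\mathbb{Z}$ with an arc from $i$ to $i+j$ exactly when $v_j=1$ (outdegrees in an induced subgraph are counted within that subgraph). -}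

module Defs where

open import Data.Nat using (ℕ; zero; suc; _+_; _∸_; _*_; NonZero)
open import Data.Nat.DivMod using (_mod_)
open import Data.Bool using (Bool; true; false; _xor_; _∧_; if_then_else_)
open import Data.Fin using (Fin; toℕ)
import Data.Fin as Fin
open import Data.Product using (Σ; _×_; ∃)
open import Relation.Binary.PropositionalEquality using (_≡_)
open import Data.Vec.Functional using (foldr)

-- Vectors in F₂ⁿ, coordinates indexed by Fin n (i.e. Z/nZ).
F2^ : ℕ → Set
F2^ n = Fin n → Bool

_⊕_ : ∀ {n} .{{_ : NonZero n}} → Fin n → Fin n → Fin n
_⊕_ {n} i j = (toℕ i + toℕ j) mod n

_⊖_ : ∀ {n} .{{_ : NonZero n}} → Fin n → Fin n → Fin n
_⊖_ {n} i j = (toℕ i + (n ∸ toℕ j)) mod n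

parity : ∀ {n} → F2^ n → Bool
parity = foldr _xor_ false

_·_ : ∀ {n} → F2^ n → F2^ n → Bool
v · w = parity (λ i → v i ∧ w i)

-- Cyclic shift: (σ x)_{i+1} = x_i, i.e. (σ x)_j = x_{j-1}.
σ : ∀ {n} .{{_ : NonZero n}} → F2^ n → F2^ n
σ {suc n} x j = x (j ⊖ (1 mod suc n))

σ^ : ∀ {n} .{{_ : NonZero n}} → ℕ → F2^ n → F2^ n
σ^ zero x = x
σ^ (suc k) x = σ (σ^ k x)

WorkTogether : ∀ {n} .{{_ : NonZero n}} → F2^ n → F2^ n → Set
WorkTogether {n} v w =
  (x : F2^ n) → Σ (Fin n) λ k →
    (v · σ^ (toℕ k) x ≡ false) × (w · σ^ (toℕ k) x ≡ false)

ē : ∀ {n} → F2^ n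
ē Fin.zero = false
ē (Fin.suc _) = true

-- Cayley digraph G_v on Z/nZ: arc from i to j iff v_{j-i} = 1.
Arc : ∀ {n} .{{_ : NonZero n}} → F2^ n → Fin n → Fin n → Bool
Arc v i j = v (j ⊖ i)

outdegParity : ∀ {n} .{{_ : NonZero n}} → F2^ n → F2^ n → Fin n → Bool
outdegParity v S i = parity (λ j → S j ∧ Arc v i j)

-- S (a vertex subset, as indicator) induces a subgraph with an odd number
-- of vertices in which every vertex has odd outdegree.
OddOddInduced : ∀ {n} .{{_ : NonZero n}} → F2^ n → F2^ n → Set
OddOddInduced v S =
  (parity S ≡ true) × (∀ i → S i ≡ true → outdegParity v S i ≡ true)

module Submission where

open import Defs
open import Data.Nat using (ℕ; suc; _*_)
open import Data.Bool using (Bool; false)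
open import Data.Fin using (Fin; zero)
open import Data.Product using (Σ)
open import Relation.Nullary using (¬_)
open import Relation.Binary.PropositionalEquality using (_≡_)
open import Function.Bundles using (_⇔_)

open import Data.Nat using (zero; _+_; _∸_; _%_)
open import Data.Nat.Properties using (+-assoc; +-comm; +-suc; +-identityʳ; m∸n+n≡m; <⇒≤)
open import Data.Nat.DivMod using (_mod_; m%n<n; %-distribˡ-+; m%n%n≡m%n; [m+n]%n≡m%n; m<n⇒m%n≡m)
open import Data.Bool using (true; not; _∧_; _xor_)
open import Data.Bool.Properties
  using (_≟_; ¬-not; not-injective; not-involutive; xor-same; xor-assoc; ∧-comm; ∧-distribʳ-xor;
         xor-∧-commutativeRing)
open import Data.Fin using (toℕ)
open import Data.Fin.Properties using (toℕ-injective; toℕ<n; toℕ-fromℕ<; any?)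
open import Data.Fin.Permutation using (Permutation; permutation)
open import Data.Product using (_×_; _,_)
open import Data.Empty using (⊥-elim)
open import Function.Bundles using (mk⇔; Equivalence)
open import Relation.Nullary using (Dec; yes; no)
open import Relation.Nullary.Decidable using (_×-dec_)
open import Level using (0ℓ)
open import Relation.Binary using (Setoid; IsEquivalence)
open import Relation.Binary.PropositionalEquality
  using (refl; sym; trans; cong; cong₂; _≗_; module ≡-Reasoning)
open import Algebra.Bundles using (CommutativeRing)
import Algebra.Properties.CommutativeMonoid.Sum as CommutativeMonoidSum
import Relation.Binary.Reasoning.Setoid as SetoidReasoning

-- Write N = n + 1 for the length and let x ∈ F₂ᴺ.  The shift σᵏ
-- is the translation of coordinates by k, so if k moves vertex i to the
-- origin (i + k ≡ 0 mod N) then, by reindexing the sum,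
--     v · σᵏ x  =  parity of the outdegree of i in the subgraph of G_v induced by x,
--     ē · σᵏ x  =  x_i + parity x.
-- Hence v and ē work together iff every x has a *witness*: a vertex i of even
-- outdegree in x with x_i = parity x.  An odd set S all of whose vertices have
-- odd outdegree has no witness.  Conversely, when N is odd, a set x without a
-- witness yields such an S: x itself if parity x = 1; otherwise the whole
-- vertex set (G_v is |v|-regular) if |v| is odd, and the complement of x
-- if |v| is even.

-- Parity is the finite sum in the commutative monoid (Bool, xor, false),
-- so the library's summation lemmas apply to it.
private
  module XorSum = CommutativeMonoidSum
    (CommutativeRing.+-commutativeMonoid xor-∧-commutativeRing)

parity-cong : ∀ {k} {f g : F2^ k} → f ≗ g → parity f ≡ parity g
parity-cong = XorSum.sum-cong-≗

parity-xor : ∀ {k} (f g : F2^ k) → parity (λ j → f j xor g j) ≡ parity f xor parity g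
parity-xor = XorSum.∑-distrib-+

full : ∀ {k} → F2^ k
full _ = true

complement : ∀ {k} → F2^ k → F2^ k
complement x j = not (x j)

parity-complement : ∀ {k} (x : F2^ k) → parity (complement x) ≡ parity (full {k}) xor parity x
parity-complement x = parity-xor full x

-- The whole vertex set of an odd cycle has parity one; this is the only place
-- where the oddness of the length enters.
parity-full-even : ∀ k → parity (full {k + k}) ≡ false
parity-full-even zero = refl
parity-full-even (suc k) rewrite +-suc k k = trans (not-involutive _) (parity-full-even k)

parity-full-odd : ∀ m → parity (full {suc (2 * m)}) ≡ true
parity-full-odd m rewrite +-identityʳ m = cong not (parity-full-even m)

xor≡false⇒≡ : ∀ {a b} → a xor b ≡ false → a ≡ b
xor≡false⇒≡ {false} {false} _ = refl
xor≡false⇒≡ {true}  {true}  _ = refl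

ē-dot : ∀ {m} (y : F2^ (suc m)) → ē · y ≡ y zero xor parity y
ē-dot y = begin
  ē · y                                    ≡⟨⟩
  rest                                     ≡⟨⟩
  false xor rest                           ≡⟨ cong (_xor rest) (xor-same (y zero)) ⟨
  (y zero xor y zero) xor rest             ≡⟨ xor-assoc (y zero) (y zero) rest ⟩
  y zero xor parity y                      ∎
  where
  open ≡-Reasoning
  rest : Bool
  rest = parity (λ j → y (Data.Fin.suc j))

module Cyclic (n : ℕ) where

  N : ℕ
  N = suc n

  record _≈_ (a b : ℕ) : Set where
    constructor mk
    field residue : a % N ≡ b % N
  infix 4 _≈_

  ≈-isEquivalence : IsEquivalence _≈_
  ≈-isEquivalence = record
    { refl  = mk refl
    ; sym   = λ (mk p) → mk (sym p)
    ; trans = λ (mk p) (mk q) → mk (trans p q)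
    }

  ≈-setoid : Setoid 0ℓ 0ℓ
  ≈-setoid = record { isEquivalence = ≈-isEquivalence }

  open IsEquivalence ≈-isEquivalence using ()
    renaming (refl to ≈-refl; sym to ≈-sym; trans to ≈-trans; reflexive to ≡⇒≈)

  +-cong : ∀ {a b c d} → a ≈ b → c ≈ d → a + c ≈ b + d
  +-cong {a} {b} {c} {d} (mk p) (mk q) = mk (begin
    (a + c) % N            ≡⟨ %-distribˡ-+ a c N ⟩
    (a % N + c % N) % N    ≡⟨ cong₂ (λ x y → (x + y) % N) p q ⟩
    (b % N + d % N) % N    ≡⟨ %-distribˡ-+ b d N ⟨
    (b + d) % N            ∎)
    where open ≡-Reasoning

  +-congˡ : ∀ a {c d} → c ≈ d → a + c ≈ a + d
  +-congˡ a = +-cong (≈-refl {a})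

  +-congʳ : ∀ {a b} c → a ≈ b → a + c ≈ b + c
  +-congʳ c p = +-cong p (≈-refl {c})

  mod≈ : ∀ a → a % N ≈ a
  mod≈ a = mk (m%n%n≡m%n a N)

  +N≈ : ∀ a → a + N ≈ a
  +N≈ a = mk ([m+n]%n≡m%n a N)

  -- Every residue has an additive inverse, so addition can be cancelled.
  +-cancelʳ : ∀ {a b} k → a + k ≈ b + k → a ≈ b
  +-cancelʳ {a} {b} k p = begin
    a                      ≈⟨ undo a ⟨
    a + k + (N ∸ k % N)    ≈⟨ +-congʳ (N ∸ k % N) p ⟩
    b + k + (N ∸ k % N)    ≈⟨ undo b ⟩
    b                      ∎
    where
    open SetoidReasoning ≈-setoid
    undo : ∀ c → c + k + (N ∸ k % N) ≈ c
    undo c = begin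
      c + k + (N ∸ k % N)          ≈⟨ +-congʳ (N ∸ k % N) (+-congˡ c (mod≈ k)) ⟨
      c + k % N + (N ∸ k % N)      ≡⟨ +-assoc c (k % N) (N ∸ k % N) ⟩
      c + (k % N + (N ∸ k % N))    ≡⟨ cong (c +_) (+-comm (k % N) (N ∸ k % N)) ⟩
      c + (N ∸ k % N + k % N)      ≡⟨ cong (c +_) (m∸n+n≡m (<⇒≤ (m%n<n k N))) ⟩
      c + N                        ≈⟨ +N≈ c ⟩
      c                            ∎

  fin-eq : ∀ {i j : Fin N} → toℕ i ≈ toℕ j → i ≡ j
  fin-eq {i} {j} (mk p) = toℕ-injective
    (trans (sym (m<n⇒m%n≡m (toℕ<n i))) (trans p (m<n⇒m%n≡m (toℕ<n j))))

  mod-spec : ∀ a → toℕ (a mod N) ≈ a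
  mod-spec a = ≈-trans (≡⇒≈ (toℕ-fromℕ< (m%n<n a N))) (mod≈ a)

  ⊕-spec : ∀ (a b : Fin N) → toℕ (a ⊕ b) ≈ toℕ a + toℕ b
  ⊕-spec a b = mod-spec (toℕ a + toℕ b)

  ⊖-spec : ∀ (a b : Fin N) → toℕ (a ⊖ b) + toℕ b ≈ toℕ a
  ⊖-spec a b = begin
    toℕ (a ⊖ b) + toℕ b                 ≈⟨ +-congʳ (toℕ b) (mod-spec (toℕ a + (N ∸ toℕ b))) ⟩
    toℕ a + (N ∸ toℕ b) + toℕ b         ≡⟨ +-assoc (toℕ a) (N ∸ toℕ b) (toℕ b) ⟩
    toℕ a + (N ∸ toℕ b + toℕ b)         ≡⟨ cong (toℕ a +_) (m∸n+n≡m (<⇒≤ (toℕ<n b))) ⟩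
    toℕ a + N                           ≈⟨ +N≈ (toℕ a) ⟩
    toℕ a                               ∎
    where open SetoidReasoning ≈-setoid

  ⊖-unique : ∀ {a b c : Fin N} → toℕ c + toℕ b ≈ toℕ a → c ≡ a ⊖ b
  ⊖-unique {a} {b} p = fin-eq (+-cancelʳ (toℕ b) (≈-trans p (≈-sym (⊖-spec a b))))

  -- Translation by t is a permutation of Z/NZ, so it preserves parity.
  translation : Fin N → Permutation N N
  translation t = permutation (_⊖ t) (_⊕ t)
    (λ y → sym (⊖-unique (≈-sym (⊕-spec y t))))
    (λ x → fin-eq (≈-trans (⊕-spec (x ⊖ t) t) (⊖-spec x t)))

  parity-translate : ∀ (t : Fin N) (f : F2^ N) → parity (λ j → f (j ⊖ t)) ≡ parity f
  parity-translate t f = sym (XorSum.sum-permute f (translation t))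

  σ^-at : ∀ k (x : F2^ N) {c j : Fin N} → toℕ c + k ≈ toℕ j → σ^ k x j ≡ x c
  σ^-at zero x {c} p =
    cong x (sym (fin-eq (≈-trans (≡⇒≈ (sym (+-identityʳ (toℕ c)))) p)))
  σ^-at (suc k) x {c} {j} p = σ^-at k x (+-cancelʳ 1 (begin
    toℕ c + k + 1                     ≡⟨ +-comm (toℕ c + k) 1 ⟩
    suc (toℕ c + k)                   ≡⟨ +-suc (toℕ c) k ⟨
    toℕ c + suc k                     ≈⟨ p ⟩
    toℕ j                             ≈⟨ ⊖-spec j one ⟨
    toℕ (j ⊖ one) + toℕ one           ≈⟨ +-congˡ (toℕ (j ⊖ one)) (mod-spec 1) ⟩
    toℕ (j ⊖ one) + 1                 ∎))
    where
    open SetoidReasoning ≈-setoid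
    one : Fin N
    one = 1 mod N

  parity-σ^ : ∀ k (x : F2^ N) → parity (σ^ k x) ≡ parity x
  parity-σ^ k x = trans (parity-cong shifted) (parity-translate (k mod N) x)
    where
    shifted : ∀ j → σ^ k x j ≡ x (j ⊖ (k mod N))
    shifted j = σ^-at k x (≈-trans (+-congˡ (toℕ (j ⊖ (k mod N))) (≈-sym (mod-spec k)))
                                   (⊖-spec j (k mod N)))

  record _centres_ (k : ℕ) (i : Fin N) : Set where
    constructor centring
    field at-origin : toℕ i + k ≈ 0

  centred-moves : ∀ {k i} → k centres i → ∀ (l : Fin N) → toℕ l + k ≈ toℕ (l ⊖ i)
  centred-moves {k} {i} (centring centred) l = begin
    toℕ l + k                       ≈⟨ +-congʳ k (⊖-spec l i) ⟨
    toℕ (l ⊖ i) + toℕ i + k         ≡⟨ +-assoc (toℕ (l ⊖ i)) (toℕ i) k ⟩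
    toℕ (l ⊖ i) + (toℕ i + k)       ≈⟨ +-congˡ (toℕ (l ⊖ i)) centred ⟩
    toℕ (l ⊖ i) + 0                 ≡⟨ +-identityʳ (toℕ (l ⊖ i)) ⟩
    toℕ (l ⊖ i)                     ∎
    where open SetoidReasoning ≈-setoid

  dot-centred : ∀ (v x : F2^ N) {k i} → k centres i → v · σ^ k x ≡ outdegParity v x i
  dot-centred v x {k} {i} centred = begin
    parity (λ j → v j ∧ σ^ k x j)                ≡⟨ parity-translate i (λ j → v j ∧ σ^ k x j) ⟨
    parity (λ l → v (l ⊖ i) ∧ σ^ k x (l ⊖ i))
      ≡⟨ parity-cong (λ l → cong (v (l ⊖ i) ∧_) (σ^-at k x (centred-moves centred l))) ⟩
    parity (λ l → v (l ⊖ i) ∧ x l)               ≡⟨ parity-cong (λ l → ∧-comm (v (l ⊖ i)) (x l)) ⟩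
    outdegParity v x i                           ∎
    where open ≡-Reasoning

  ē-centred : ∀ (x : F2^ N) {k i} → k centres i → ē · σ^ k x ≡ x i xor parity x
  ē-centred x {k} centred =
    trans (ē-dot (σ^ k x)) (cong₂ _xor_ (σ^-at k x (_centres_.at-origin centred)) (parity-σ^ k x))

  centred-vertex : ∀ (k : Fin N) → toℕ k centres (zero ⊖ k)
  centred-vertex k = centring (⊖-spec zero k)

  centring-shift : ∀ (i : Fin N) → toℕ (zero ⊖ i) centres i
  centring-shift i = centring (≈-trans (≡⇒≈ (+-comm (toℕ i) _)) (⊖-spec zero i))

  Witness : F2^ N → F2^ N → Fin N → Set
  Witness v x i = (outdegParity v x i ≡ false) × (x i xor parity x ≡ false)

  -- Being a witness is decidable, so a missing witness can be found by search.
  witness? : ∀ v x i → Dec (Witness v x i)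
  witness? v x i = (outdegParity v x i ≟ false) ×-dec (x i xor parity x ≟ false)

  workTogether⇔witnessed : ∀ v → WorkTogether v ē ⇔ (∀ x → Σ (Fin N) (Witness v x))
  workTogether⇔witnessed v = mk⇔ to from
    where
    to : WorkTogether v ē → ∀ x → Σ (Fin N) (Witness v x)
    to together x with together x
    ... | k , vσx≡0 , ēσx≡0 =
      zero ⊖ k , trans (sym (dot-centred v x (centred-vertex k))) vσx≡0
               , trans (sym (ē-centred x (centred-vertex k))) ēσx≡0
    from : (∀ x → Σ (Fin N) (Witness v x)) → WorkTogether v ē
    from witnessed x with witnessed x
    ... | i , even , balanced =
      zero ⊖ i , trans (dot-centred v x (centring-shift i)) even
               , trans (ē-centred x (centring-shift i)) balanced

  -- G_v is |v|-regular, so in the whole vertex set every outdegree is |v|.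
  outdeg-full : ∀ v i → outdegParity v full i ≡ parity v
  outdeg-full v i = parity-translate i v

  outdeg-complement : ∀ v x i →
    outdegParity v (complement x) i ≡ parity v xor outdegParity v x i
  outdeg-complement v x i = begin
    parity (λ j → not (x j) ∧ v (j ⊖ i))                         ≡⟨ parity-cong (λ j → ∧-distribʳ-xor (v (j ⊖ i)) true (x j)) ⟩
    parity (λ j → v (j ⊖ i) xor (x j ∧ v (j ⊖ i)))               ≡⟨ parity-xor (λ j → v (j ⊖ i)) (λ j → x j ∧ v (j ⊖ i)) ⟩
    parity (λ j → v (j ⊖ i)) xor outdegParity v x i              ≡⟨ cong (_xor outdegParity v x i) (outdeg-full v i) ⟩
    parity v xor outdegParity v x i                              ∎
    where open ≡-Reasoning

  oddOdd⇒unwitnessed : ∀ v S → OddOddInduced v S → ¬ Σ (Fin N) (Witness v S)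
  oddOdd⇒unwitnessed v S (odd-size , odd-outdeg) (i , even , balanced)
    with () ← trans (sym (odd-outdeg i (trans (xor≡false⇒≡ balanced) odd-size))) even

  unwitnessed⇒forced : ∀ v x → ¬ Σ (Fin N) (Witness v x) →
    ∀ i → x i ≡ parity x → outdegParity v x i ≡ true
  unwitnessed⇒forced v x unwitnessed i balanced = ¬-not λ even →
    unwitnessed (i , even , trans (cong (_xor parity x) balanced) (xor-same (parity x)))

  forced⇒oddOdd : parity (full {N}) ≡ true → ∀ v x →
    (∀ i → x i ≡ parity x → outdegParity v x i ≡ true) → Σ (F2^ N) (OddOddInduced v)
  forced⇒oddOdd odd-N v x forced with parity x in parity-x | parity v in parity-v
  ... | true  | _     = x , parity-x , forced
  ... | false | true  = full , odd-N , λ i _ → trans (outdeg-full v i) parity-v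
  ... | false | false = complement x
      , trans (parity-complement x) (cong₂ _xor_ odd-N parity-x)
      , λ i not-xᵢ → trans (outdeg-complement v x i)
          (cong₂ _xor_ parity-v (forced i (not-injective not-xᵢ)))

  workTogether⇔noOddOdd : parity (full {N}) ≡ true → ∀ v →
    WorkTogether v ē ⇔ (¬ Σ (F2^ N) (OddOddInduced v))
  workTogether⇔noOddOdd odd-N v = mk⇔
    (λ together (S , oddOdd) →
      oddOdd⇒unwitnessed v S oddOdd (Equivalence.to criterion together S))
    (λ noOddOdd → Equivalence.from criterion λ x → witness-of noOddOdd x)
    where
    criterion : WorkTogether v ē ⇔ (∀ x → Σ (Fin N) (Witness v x))
    criterion = workTogether⇔witnessed v
    witness-of : ¬ Σ (F2^ N) (OddOddInduced v) → ∀ x → Σ (Fin N) (Witness v x)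
    witness-of noOddOdd x with any? (witness? v x)
    ... | yes witnessed = witnessed
    ... | no unwitnessed =
      ⊥-elim (noOddOdd (forced⇒oddOdd odd-N v x (unwitnessed⇒forced v x unwitnessed)))

-- Proposition 4.1: the case N = 2m + 1 of the criterion.
proposition4p1 : (m : ℕ) → (v : F2^ (suc (2 * m))) → v zero ≡ false →
    WorkTogether v ē ⇔ (¬ Σ (F2^ (suc (2 * m))) λ S → OddOddInduced v S)
proposition4p1 m v _ = Cyclic.workTogether⇔noOddOdd (2 * m) (parity-full-odd m) v
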